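{- Let $q>2$ be a prime power and $n\ge 1$ an integer with $\gcd(n,q)=1$, and let $A_n=GF(q)[x]/(x^n-1)$. Let $J\subseteq A_n$ be an ideal (cyclic code) with parity-check polynomial $h(x)=\prod_{i=1}^{t}h_i(x)$, where $h_1,\dots,h_t$ are distinct monic irreducible polynomials over $GF(q)$ dividing $x^n-1$. Let $c(x)=\prod_{j=1}^{k}h_{i_j}(x)$, $1\le k\le t$, be a product of some $k$ distinct factors among $h_1,\dots,h_t$, and let $C$ be the set of all elements of $J$ whose minimal polynomial is $c(x)$. Let $n_c=\mathrm{ord}(c(x))$, let $s_c$ be the number of distinct cycles contained in $C$, and let $R_c$ be the number of distinct proportionality classes contained in $C$. Then $$n_c\cdot s_c=R_c\cdot (q-1).$$
   Context: $GF(q)^*$ is the multiplicative group of $GF(q)$. The ideal $J$ with parity-check polynomial $h$ is the ideal of $A_n$ generated by $g(x)=(x^n-1)/h(x)$; equivalently $J=\{z\in A_n: h(x)z(x)=0 \text{ in } A_n\}$. For $z\in A_n$, its minimal polynomial is the monic polynomial $c\in GF(q)[x]$ of least degree such that $c(x)z(x)\equiv 0 \pmod{x^n-1}$. For a polynomial $f$ with $f(0)\neq 0$, $\mathrm{ord}(f)$ is the least integer $e\ge 1$ with $f\mid x^e-1$. For nonzero $z\in A_n$, the proportionality class of $z$ is $P_z=\{\alpha z:\alpha\in GF(q)^*\}$, and the cycle of $z$ is $\{x^jz: j\ge 0\}$ (computed in $A_n$). Both $C$ is closed under multiplication by $x$ and by elements of $GF(q)^*$, so it is a disjoint union of cycles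 and a disjoint union of proportionality classes. -}

module Defs where

open import Level using (0ℓ)
open import Data.Nat as ℕ using (ℕ; zero; suc; _≤_; _<_)
open import Data.Nat.Primality using (Prime)
open import Data.Fin as F using (Fin)
open import Data.Vec as Vec using (Vec; []; _∷_)
open import Data.List as List using (List; []; _∷_; replicate; _++_)
open import Data.Product using (Σ; ∃; _×_; _,_)
open import Data.Sum using (_⊎_)
open import Function using (_∘_; _↔_)
open import Relation.Nullary using (¬_)
open import Relation.Binary.PropositionalEquality using (_≡_; _≢_)
open import Algebra.Core using (Op₁; Op₂)
open import Algebra.Structures using (IsCommutativeRing)

IsPrimePower : ℕ → Set
IsPrimePower q = Σ ℕ λ p → Σ ℕ λ k → Prime p × q ≡ p ℕ.^ suc k

-- A finite field with exactly q elements (equality is propositional equality).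
-- Any finite field of order q is isomorphic to GF(q).
record FiniteField (q : ℕ) : Set₁ where
  field
    F    : Set
    _+_  : Op₂ F
    _*_  : Op₂ F
    -_   : Op₁ F
    0#   : F
    1#   : F
    isCommutativeRing : IsCommutativeRing _≡_ _+_ _*_ -_ 0# 1#
    0≢1  : 0# ≢ 1#
    inverse : ∀ x → x ≢ 0# → ∃ λ y → x * y ≡ 1#
    enum : F ↔ Fin q

module Theory {q : ℕ} (𝔽 : FiniteField q) where
  open FiniteField 𝔽 hiding (F)
  open FiniteField 𝔽 using () renaming (F to K)

  -- polynomials over F: coefficient lists, lowest degree first
  -- (trailing zeros allowed; equality is coefficientwise)
  Poly : Set
  Poly = List K

  coeff : Poly → ℕ → K
  coeff []       _       = 0#
  coeff (a ∷ f)  zero    = a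
  coeff (a ∷ f)  (suc i) = coeff f i

  _≈ₚ_ : Poly → Poly → Set
  f ≈ₚ g = ∀ i → coeff f i ≡ coeff g i

  addP : Poly → Poly → Poly
  addP []       g        = g
  addP (a ∷ f)  []       = a ∷ f
  addP (a ∷ f)  (b ∷ g)  = (a + b) ∷ addP f g

  mulP : Poly → Poly → Poly
  mulP []       g = []
  mulP (a ∷ f)  g = addP (List.map (a *_) g) (0# ∷ mulP f g)

  _∣ₚ_ : Poly → Poly → Set
  f ∣ₚ g = ∃ λ u → mulP f u ≈ₚ g

  MonicDeg : Poly → ℕ → Set
  MonicDeg f d = coeff f d ≡ 1# × (∀ i → d < i → coeff f i ≡ 0#)

  Monic : Poly → Set
  Monic f = ∃ λ d → MonicDeg f d

  IsUnit : Poly → Set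
  IsUnit f = ∃ λ u → mulP f u ≈ₚ (1# ∷ [])

  Irreducible : Poly → Set
  Irreducible f = ¬ (f ≈ₚ []) × ¬ IsUnit f ×
                  (∀ a b → mulP a b ≈ₚ f → IsUnit a ⊎ IsUnit b)

  xpow-1 : ℕ → Poly
  xpow-1 e = addP (replicate e 0# ++ (1# ∷ [])) ((- 1#) ∷ [])

  prodP : ∀ {t} → (Fin t → Poly) → Poly
  prodP {zero}  f = 1# ∷ []
  prodP {suc t} f = mulP (f F.zero) (prodP (f ∘ F.suc))

  IsOrd : Poly → ℕ → Set
  IsOrd f e = 1 ≤ e × f ∣ₚ xpow-1 e × (∀ e' → 1 ≤ e' → f ∣ₚ xpow-1 e' → e ≤ e')

  -- A_n = F[x]/(x^n - 1), elements represented by their canonical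
  -- representatives of degree < n (coefficient vectors)
  A : ℕ → Set
  A n = Vec K n

  toPoly : ∀ {n} → A n → Poly
  toPoly = Vec.toList

  Annihilates : ∀ {n} → Poly → A n → Set
  Annihilates {n} c z = xpow-1 n ∣ₚ mulP c (toPoly z)

  IsMinPoly : ∀ {n} → A n → Poly → Set
  IsMinPoly z c = ∃ λ d → MonicDeg c d × Annihilates c z ×
                  (∀ c' d' → MonicDeg c' d' → Annihilates c' z → d ≤ d')

  -- the ideal J with parity-check polynomial h: {z : h z = 0 in A_n}
  InIdeal : ∀ {n} → Poly → A n → Set
  InIdeal h z = Annihilates h z

  mulX : ∀ {n} → A n → A n
  mulX {zero}  []  = []
  mulX {suc n} v   = Vec.last v ∷ Vec.init v

  mulXPow : ∀ {n} → ℕ → A n → A n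
  mulXPow zero    z = z
  mulXPow (suc j) z = mulX (mulXPow j z)

  scale : ∀ {n} → K → A n → A n
  scale α = Vec.map (α *_)

  InCycle : ∀ {n} → A n → A n → Set
  InCycle z w = ∃ λ j → w ≡ mulXPow j z

  InPropClass : ∀ {n} → A n → A n → Set
  InPropClass z w = ∃ λ α → α ≢ 0# × w ≡ scale α z

  SameSet : ∀ {n} → (A n → Set) → (A n → Set) → Set
  SameSet {n} P Q = ∀ (w : A n) → (P w → Q w) × (Q w → P w)

  -- the number of distinct sets K z (z ∈ C) is s:
  -- representatives rep 0..s-1 in C giving pairwise distinct sets,
  -- and every K z with z ∈ C equals one of them
  NumDistinct : ∀ {n} → (A n → Set) → (A n → A n → Set) → ℕ → Set
  NumDistinct {n} C K s =
    Σ (Fin s → A n) λ rep →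
      (∀ i → C (rep i)) ×
      (∀ i j → SameSet (K (rep i)) (K (rep j)) → i ≡ j) ×
      (∀ z → C z → ∃ λ i → SameSet (K z) (K (rep i)))

{-# OPTIONS --safe #-}
-- Multiplication by x and by a nonzero scalar are invertible on A n and commute with multiplication
-- by polynomials, so z, x^j z and α z have the same annihilators and hence the same minimal
-- polynomial: C is closed under both operations and is partitioned both into cycles and into
-- proportionality classes. Since c is the minimal polynomial of every z ∈ C, x^e z = z holds iff
-- c ∣ x^e - 1, so each cycle has exactly ord(c) = n_c elements; since c is not constant, z ≠ 0 and each
-- class has exactly q - 1 elements. Counting C in both ways gives n_c s_c = R_c (q - 1).
module Submission where

open import Level using (0ℓ)
open import Data.Nat using (ℕ; zero; suc; _≤_; _<_; z≤n; s≤s)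
import Data.Nat as ℕ
import Data.Nat.Properties as ℕ
import Data.Nat.DivMod as ℕ
open import Data.Fin using (Fin)
import Data.Fin as Fin
import Data.Fin.Properties as Fin
open import Data.Vec as Vec using ([]; _∷_; _∷ʳ_)
import Data.Vec.Properties as Vec
open import Data.List as List using ([]; _∷_; _++_; replicate)
open import Data.Product using (_×_; ∃; _,_; proj₁; proj₂)
open import Data.Sum using (_⊎_; inj₁; inj₂; map₂; [_,_]′)
open import Data.Empty using (⊥-elim)
open import Relation.Nullary using (¬_; Dec; yes; no)
open import Relation.Binary.Bundles using (Setoid)
open import Relation.Binary.Definitions using (tri<; tri≈; tri>)
open import Relation.Binary.PropositionalEquality
  using (_≡_; _≢_; refl; sym; trans; cong; cong₂; subst; module ≡-Reasoning)
import Relation.Binary.Reasoning.Setoid as SetoidReasoning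
open import Function using (_∘_; _↔_; Inverse; Injection)
open import Function.Definitions using (Injective)
open import Function.Properties.Inverse using (↔⇒↣; ↔-sym)
open import Algebra.Bundles using (CommutativeRing)

open import Defs

-- Counting through enumerations

record Enumeration {X I : Set} (P : X → Set) : Set where
  field
    elem            : I → X
    elem-∈          : ∀ i → P (elem i)
    elem-injective  : Injective _≡_ _≡_ elem
    elem-surjective : ∀ x → P x → ∃ λ i → elem i ≡ x

module _ {X : Set} {P : X → Set} where
  open Enumeration

  enumeration-size-≤ : ∀ {m m′} → Enumeration {I = Fin m} P → Enumeration {I = Fin m′} P → m ≤ m′
  enumeration-size-≤ E E′ = Fin.injective⇒≤ {f = index} index-injective
    where
    index : Fin _ → Fin _
    index i = proj₁ (elem-surjective E′ (elem E i) (elem-∈ E i))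

    index-injective : Injective _≡_ _≡_ index
    index-injective {i} {j} e = elem-injective E (begin
      elem E i               ≡⟨ sym (proj₂ (elem-surjective E′ (elem E i) (elem-∈ E i))) ⟩
      elem E′ (index i)      ≡⟨ cong (elem E′) e ⟩
      elem E′ (index j)      ≡⟨ proj₂ (elem-surjective E′ (elem E j) (elem-∈ E j)) ⟩
      elem E j               ∎)
      where open ≡-Reasoning

  enumeration-size-unique : ∀ {m m′} → Enumeration {I = Fin m} P → Enumeration {I = Fin m′} P → m ≡ m′
  enumeration-size-unique E E′ = ℕ.≤-antisym (enumeration-size-≤ E E′) (enumeration-size-≤ E′ E)

  reindex : ∀ {I J} → I ↔ J → Enumeration {I = J} P → Enumeration {I = I} P
  reindex φ E = record
    { elem            = elem E ∘ to
    ; elem-∈          = elem-∈ E ∘ to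
    ; elem-injective  = Injection.injective (↔⇒↣ φ) ∘ elem-injective E
    ; elem-surjective = λ x px → let (j , ej) = elem-surjective E x px in
                          from j , trans (cong (elem E) (strictlyInverseˡ j)) ej
    }
    where open Inverse φ

punchedEnumeration : ∀ {X : Set} {m} → X ↔ Fin (suc m) → (x : X) → Enumeration {I = Fin m} (_≢ x)
punchedEnumeration {X} e x = record
  { elem            = elem
  ; elem-∈          = λ i ex → Fin.punchInᵢ≢i (to x) i (trans (sym (strictlyInverseˡ _)) (cong to ex))
  ; elem-injective  = λ {i} {j} eq → Fin.punchIn-injective (to x) i j (Injection.injective (↔⇒↣ (↔-sym e)) eq)
  ; elem-surjective = λ y y≢x → let x≢y = λ eq → y≢x (Injection.injective (↔⇒↣ e) (sym eq)) in
      Fin.punchOut x≢y , trans (cong from (Fin.punchIn-punchOut x≢y)) (strictlyInverseʳ y)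
  }
  where
  open Inverse e
  elem : Fin _ → X
  elem = from ∘ Fin.punchIn (to x)

module _ {q : ℕ} (𝔽 : FiniteField q) where
  open Theory 𝔽
  open FiniteField 𝔽 using (0#; 1#; 0≢1; inverse; enum; isCommutativeRing)
    renaming (F to K; _+_ to infixl 6 _+_; _*_ to infixl 7 _*_; -_ to infix 8 -_)

  ring : CommutativeRing 0ℓ 0ℓ
  ring = record { isCommutativeRing = isCommutativeRing }

  open CommutativeRing ring using (+-identityˡ; +-identityʳ; +-comm; +-assoc; -‿inverseˡ; -‿inverseʳ;
    *-comm; *-assoc; *-identityˡ; *-identityʳ; zeroˡ; zeroʳ; distribˡ; distribʳ; +-commutativeSemigroup)
  open import Algebra.Properties.CommutativeSemigroup +-commutativeSemigroup using (interchange; x∙yz≈y∙xz)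
  open import Algebra.Properties.Ring (CommutativeRing.ring ring) using (-‿distribʳ-*; -1*x≈-x)
  open import Algebra.Properties.Group (CommutativeRing.+-group ring) using (x∙y⁻¹≈ε⇒x≈y)

  _≟_ : (a b : K) → Dec (a ≡ b)
  a ≟ b with Inverse.to enum a Fin.≟ Inverse.to enum b
  ... | yes e = yes (Injection.injective (↔⇒↣ enum) e)
  ... | no ne = no (ne ∘ cong (Inverse.to enum))

  1≢0 : 1# ≢ 0#
  1≢0 = 0≢1 ∘ sym

  inverse-nonzero : ∀ {a b} → a * b ≡ 1# → b ≢ 0#
  inverse-nonzero {a} e b≡0 = 1≢0 (trans (sym e) (trans (cong (a *_) b≡0) (zeroʳ a)))

  *-cancelʳ-nonzero : ∀ {a} b c → a ≢ 0# → b * a ≡ c * a → b ≡ c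
  *-cancelʳ-nonzero {a} b c a≢0 e with inverse a a≢0
  ... | a⁻¹ , aa⁻¹ = begin
    b              ≡⟨ sym (*-identityʳ b) ⟩
    b * 1#         ≡⟨ cong (b *_) (sym aa⁻¹) ⟩
    b * (a * a⁻¹)  ≡⟨ sym (*-assoc b a a⁻¹) ⟩
    b * a * a⁻¹    ≡⟨ cong (_* a⁻¹) e ⟩
    c * a * a⁻¹    ≡⟨ *-assoc c a a⁻¹ ⟩
    c * (a * a⁻¹)  ≡⟨ cong (c *_) aa⁻¹ ⟩
    c * 1#         ≡⟨ *-identityʳ c ⟩
    c              ∎
    where open ≡-Reasoning

  *-nonzero : ∀ {a b} → a ≢ 0# → b ≢ 0# → a * b ≢ 0#
  *-nonzero {a} {b} a≢0 b≢0 e = b≢0 (*-cancelʳ-nonzero b 0# a≢0 (trans (*-comm b a) (trans e (sym (zeroˡ a)))))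

  -- Polynomials up to coefficientwise equality

  -- A record wrapper around _≈ₚ_, so that the two polynomials can be inferred from a proof.
  infix 4 _≋_
  record _≋_ (f g : Poly) : Set where
    constructor mk≋
    field coeff-≡ : ∀ i → coeff f i ≡ coeff g i
  open _≋_

  ≋-refl : ∀ {f} → f ≋ f
  ≋-refl = mk≋ λ _ → refl

  ≋-sym : ∀ {f g} → f ≋ g → g ≋ f
  ≋-sym e = mk≋ λ i → sym (coeff-≡ e i)

  ≋-trans : ∀ {f g h} → f ≋ g → g ≋ h → f ≋ h
  ≋-trans e e′ = mk≋ λ i → trans (coeff-≡ e i) (coeff-≡ e′ i)

  ≋-setoid : Setoid 0ℓ 0ℓ
  ≋-setoid = record { Carrier = Poly ; _≈_ = _≋_
                    ; isEquivalence = record { refl = ≋-refl ; sym = ≋-sym ; trans = ≋-trans } }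

  module ≋-Reasoning = SetoidReasoning ≋-setoid

  scaleP : K → Poly → Poly
  scaleP a = List.map (a *_)

  negP : Poly → Poly
  negP = scaleP (- 1#)

  coeff-addP : ∀ f g i → coeff (addP f g) i ≡ coeff f i + coeff g i
  coeff-addP []      g       i       = sym (+-identityˡ _)
  coeff-addP (a ∷ f) []      i       = sym (+-identityʳ _)
  coeff-addP (a ∷ f) (b ∷ g) zero    = refl
  coeff-addP (a ∷ f) (b ∷ g) (suc i) = coeff-addP f g i

  coeff-scaleP : ∀ a f i → coeff (scaleP a f) i ≡ a * coeff f i
  coeff-scaleP a []      i       = sym (zeroʳ a)
  coeff-scaleP a (b ∷ f) zero    = refl
  coeff-scaleP a (b ∷ f) (suc i) = coeff-scaleP a f i

  ∷-cong : ∀ {a b f g} → a ≡ b → f ≋ g → a ∷ f ≋ b ∷ g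
  ∷-cong e e′ = mk≋ λ { zero → e ; (suc i) → coeff-≡ e′ i }

  ∷-injectiveʳ : ∀ {a b f g} → a ∷ f ≋ b ∷ g → f ≋ g
  ∷-injectiveʳ e = mk≋ (coeff-≡ e ∘ suc)

  ∷-≋[] : ∀ {a f} → a ∷ f ≋ [] → f ≋ []
  ∷-≋[] e = mk≋ (coeff-≡ e ∘ suc)

  0∷[]≋[] : 0# ∷ [] ≋ []
  0∷[]≋[] = mk≋ λ { zero → refl ; (suc i) → refl }

  addP-cong : ∀ {f f′ g g′} → f ≋ f′ → g ≋ g′ → addP f g ≋ addP f′ g′
  addP-cong {f} {f′} {g} {g′} e e′ = mk≋ λ i → begin
    coeff (addP f g) i       ≡⟨ coeff-addP f g i ⟩
    coeff f i + coeff g i    ≡⟨ cong₂ _+_ (coeff-≡ e i) (coeff-≡ e′ i) ⟩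
    coeff f′ i + coeff g′ i  ≡⟨ coeff-addP f′ g′ i ⟨
    coeff (addP f′ g′) i     ∎
    where open ≡-Reasoning

  addP-congˡ : ∀ {f f′} g → f ≋ f′ → addP f g ≋ addP f′ g
  addP-congˡ g e = addP-cong e ≋-refl

  addP-congʳ : ∀ f {g g′} → g ≋ g′ → addP f g ≋ addP f g′
  addP-congʳ f e = addP-cong ≋-refl e

  addP-identityʳ : ∀ f → addP f [] ≋ f
  addP-identityʳ []      = ≋-refl
  addP-identityʳ (a ∷ f) = ≋-refl

  addP-assoc : ∀ f g h → addP (addP f g) h ≋ addP f (addP g h)
  addP-assoc f g h = mk≋ λ i → begin
    coeff (addP (addP f g) h) i              ≡⟨ coeff-addP (addP f g) h i ⟩
    coeff (addP f g) i + coeff h i           ≡⟨ cong (_+ coeff h i) (coeff-addP f g i) ⟩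
    coeff f i + coeff g i + coeff h i        ≡⟨ +-assoc _ _ _ ⟩
    coeff f i + (coeff g i + coeff h i)      ≡⟨ cong (coeff f i +_) (coeff-addP g h i) ⟨
    coeff f i + coeff (addP g h) i           ≡⟨ coeff-addP f (addP g h) i ⟨
    coeff (addP f (addP g h)) i              ∎
    where open ≡-Reasoning

  addP-interchange : ∀ f g h k → addP (addP f g) (addP h k) ≋ addP (addP f h) (addP g k)
  addP-interchange f g h k = mk≋ λ i → begin
    coeff (addP (addP f g) (addP h k)) i                   ≡⟨ coeff-addP (addP f g) (addP h k) i ⟩
    coeff (addP f g) i + coeff (addP h k) i                ≡⟨ cong₂ _+_ (coeff-addP f g i) (coeff-addP h k i) ⟩
    (coeff f i + coeff g i) + (coeff h i + coeff k i)      ≡⟨ interchange _ _ _ _ ⟩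
    (coeff f i + coeff h i) + (coeff g i + coeff k i)      ≡⟨ cong₂ _+_ (coeff-addP f h i) (coeff-addP g k i) ⟨
    coeff (addP f h) i + coeff (addP g k) i                ≡⟨ coeff-addP (addP f h) (addP g k) i ⟨
    coeff (addP (addP f h) (addP g k)) i                   ∎
    where open ≡-Reasoning

  addP-leftComm : ∀ f g h → addP f (addP g h) ≋ addP g (addP f h)
  addP-leftComm f g h = mk≋ λ i → begin
    coeff (addP f (addP g h)) i          ≡⟨ coeff-addP f _ i ⟩
    coeff f i + coeff (addP g h) i       ≡⟨ cong (coeff f i +_) (coeff-addP g h i) ⟩
    coeff f i + (coeff g i + coeff h i)  ≡⟨ x∙yz≈y∙xz _ _ _ ⟩
    coeff g i + (coeff f i + coeff h i)  ≡⟨ cong (coeff g i +_) (coeff-addP f h i) ⟨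
    coeff g i + coeff (addP f h) i       ≡⟨ coeff-addP g _ i ⟨
    coeff (addP g (addP f h)) i          ∎
    where open ≡-Reasoning

  addP-inverseʳ : ∀ f → addP f (negP f) ≋ []
  addP-inverseʳ f = mk≋ λ i → begin
    coeff (addP f (negP f)) i         ≡⟨ coeff-addP f (negP f) i ⟩
    coeff f i + coeff (negP f) i      ≡⟨ cong (coeff f i +_) (trans (coeff-scaleP (- 1#) f i) (-1*x≈-x _)) ⟩
    coeff f i + - coeff f i           ≡⟨ -‿inverseʳ _ ⟩
    0#                                ∎
    where open ≡-Reasoning

  0∷-addP : ∀ f g → 0# ∷ addP f g ≋ addP (0# ∷ f) (0# ∷ g)
  0∷-addP f g = ∷-cong (sym (+-identityˡ 0#)) ≋-refl

  scaleP-cong : ∀ {a f g} → f ≋ g → scaleP a f ≋ scaleP a g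
  scaleP-cong {a} {f} {g} e = mk≋ λ i → begin
    coeff (scaleP a f) i  ≡⟨ coeff-scaleP a f i ⟩
    a * coeff f i         ≡⟨ cong (a *_) (coeff-≡ e i) ⟩
    a * coeff g i         ≡⟨ coeff-scaleP a g i ⟨
    coeff (scaleP a g) i  ∎
    where open ≡-Reasoning

  scaleP-congˡ : ∀ {a b} f → a ≡ b → scaleP a f ≋ scaleP b f
  scaleP-congˡ f refl = ≋-refl

  scaleP-distrib-addP : ∀ a f g → scaleP a (addP f g) ≋ addP (scaleP a f) (scaleP a g)
  scaleP-distrib-addP a f g = mk≋ λ i → begin
    coeff (scaleP a (addP f g)) i                  ≡⟨ coeff-scaleP a (addP f g) i ⟩
    a * coeff (addP f g) i                         ≡⟨ cong (a *_) (coeff-addP f g i) ⟩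
    a * (coeff f i + coeff g i)                    ≡⟨ distribˡ a _ _ ⟩
    a * coeff f i + a * coeff g i                  ≡⟨ cong₂ _+_ (coeff-scaleP a f i) (coeff-scaleP a g i) ⟨
    coeff (scaleP a f) i + coeff (scaleP a g) i    ≡⟨ coeff-addP (scaleP a f) (scaleP a g) i ⟨
    coeff (addP (scaleP a f) (scaleP a g)) i       ∎
    where open ≡-Reasoning

  scaleP-distrib-+ : ∀ a b f → scaleP (a + b) f ≋ addP (scaleP a f) (scaleP b f)
  scaleP-distrib-+ a b f = mk≋ λ i → begin
    coeff (scaleP (a + b) f) i                     ≡⟨ coeff-scaleP (a + b) f i ⟩
    (a + b) * coeff f i                            ≡⟨ distribʳ _ a b ⟩
    a * coeff f i + b * coeff f i                  ≡⟨ cong₂ _+_ (coeff-scaleP a f i) (coeff-scaleP b f i) ⟨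
    coeff (scaleP a f) i + coeff (scaleP b f) i    ≡⟨ coeff-addP (scaleP a f) (scaleP b f) i ⟨
    coeff (addP (scaleP a f) (scaleP b f)) i       ∎
    where open ≡-Reasoning

  scaleP-scaleP : ∀ a b f → scaleP a (scaleP b f) ≋ scaleP (a * b) f
  scaleP-scaleP a b f = mk≋ λ i → begin
    coeff (scaleP a (scaleP b f)) i  ≡⟨ coeff-scaleP a (scaleP b f) i ⟩
    a * coeff (scaleP b f) i         ≡⟨ cong (a *_) (coeff-scaleP b f i) ⟩
    a * (b * coeff f i)              ≡⟨ *-assoc a b _ ⟨
    a * b * coeff f i                ≡⟨ coeff-scaleP (a * b) f i ⟨
    coeff (scaleP (a * b) f) i       ∎
    where open ≡-Reasoning

  scaleP-identity : ∀ f → scaleP 1# f ≋ f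
  scaleP-identity f = mk≋ λ i → trans (coeff-scaleP 1# f i) (*-identityˡ _)

  scaleP-zero : ∀ f → scaleP 0# f ≋ []
  scaleP-zero f = mk≋ λ i → trans (coeff-scaleP 0# f i) (zeroˡ _)

  scaleP-0∷ : ∀ a f → scaleP a (0# ∷ f) ≋ 0# ∷ scaleP a f
  scaleP-0∷ a f = ∷-cong (zeroʳ a) ≋-refl

  mulP-0∷ˡ : ∀ f g → mulP (0# ∷ f) g ≋ 0# ∷ mulP f g
  mulP-0∷ˡ f g = addP-congˡ (0# ∷ mulP f g) (scaleP-zero g)

  mulP-congʳ : ∀ f {g g′} → g ≋ g′ → mulP f g ≋ mulP f g′
  mulP-congʳ []      e = ≋-refl
  mulP-congʳ (a ∷ f) e = addP-cong (scaleP-cong e) (∷-cong refl (mulP-congʳ f e))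

  mulP-zeroˡ : ∀ {f} g → f ≋ [] → mulP f g ≋ []
  mulP-zeroˡ {[]}    g e = ≋-refl
  mulP-zeroˡ {a ∷ f} g e = begin
    addP (scaleP a g) (0# ∷ mulP f g)  ≈⟨ addP-congʳ (scaleP a g) (∷-cong refl (mulP-zeroˡ {f} g (∷-≋[] e))) ⟩
    addP (scaleP a g) (0# ∷ [])        ≈⟨ addP-cong (scaleP-congˡ g (coeff-≡ e zero)) 0∷[]≋[] ⟩
    addP (scaleP 0# g) []              ≈⟨ addP-identityʳ (scaleP 0# g) ⟩
    scaleP 0# g                        ≈⟨ scaleP-zero g ⟩
    []                                 ∎
    where open ≋-Reasoning

  mulP-zeroʳ : ∀ g → mulP g [] ≋ []
  mulP-zeroʳ []      = ≋-refl
  mulP-zeroʳ (a ∷ g) = ≋-trans (∷-cong refl (mulP-zeroʳ g)) 0∷[]≋[]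

  mulP-congˡ : ∀ {f f′} g → f ≋ f′ → mulP f g ≋ mulP f′ g
  mulP-congˡ {[]}    {f′}     g e = ≋-sym (mulP-zeroˡ g (≋-sym e))
  mulP-congˡ {a ∷ f} {[]}     g e = mulP-zeroˡ g e
  mulP-congˡ {a ∷ f} {b ∷ f′} g e with coeff-≡ e zero
  ... | refl = addP-congʳ (scaleP a g) (∷-cong refl (mulP-congˡ g (∷-injectiveʳ e)))

  mulP-distribʳ : ∀ f g h → mulP (addP f g) h ≋ addP (mulP f h) (mulP g h)
  mulP-distribʳ []      g       h = ≋-refl
  mulP-distribʳ (a ∷ f) []      h = ≋-sym (addP-identityʳ _)
  mulP-distribʳ (a ∷ f) (b ∷ g) h = begin
    addP (scaleP (a + b) h) (0# ∷ mulP (addP f g) h)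
      ≈⟨ addP-cong (scaleP-distrib-+ a b h) (∷-cong refl (mulP-distribʳ f g h)) ⟩
    addP (addP (scaleP a h) (scaleP b h)) (0# ∷ addP (mulP f h) (mulP g h))
      ≈⟨ addP-congʳ (addP (scaleP a h) (scaleP b h)) (0∷-addP (mulP f h) (mulP g h)) ⟩
    addP (addP (scaleP a h) (scaleP b h)) (addP (0# ∷ mulP f h) (0# ∷ mulP g h))
      ≈⟨ addP-interchange (scaleP a h) (scaleP b h) _ _ ⟩
    addP (addP (scaleP a h) (0# ∷ mulP f h)) (addP (scaleP b h) (0# ∷ mulP g h))
      ∎
    where open ≋-Reasoning

  mulP-scaleˡ : ∀ a f g → mulP (scaleP a f) g ≋ scaleP a (mulP f g)
  mulP-scaleˡ a []      g = ≋-refl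
  mulP-scaleˡ a (b ∷ f) g = begin
    addP (scaleP (a * b) g) (0# ∷ mulP (scaleP a f) g)
      ≈⟨ addP-cong (≋-sym (scaleP-scaleP a b g)) (∷-cong refl (mulP-scaleˡ a f g)) ⟩
    addP (scaleP a (scaleP b g)) (0# ∷ scaleP a (mulP f g))
      ≈⟨ addP-congʳ (scaleP a (scaleP b g)) (≋-sym (scaleP-0∷ a _)) ⟩
    addP (scaleP a (scaleP b g)) (scaleP a (0# ∷ mulP f g))
      ≈⟨ scaleP-distrib-addP a (scaleP b g) _ ⟨
    scaleP a (addP (scaleP b g) (0# ∷ mulP f g))
      ∎
    where open ≋-Reasoning

  mulP-∷ʳ : ∀ g a f → mulP g (a ∷ f) ≋ addP (scaleP a g) (0# ∷ mulP g f)
  mulP-∷ʳ []      a f = ≋-sym 0∷[]≋[]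
  mulP-∷ʳ (b ∷ g) a f = begin
    addP (scaleP b (a ∷ f)) (0# ∷ mulP g (a ∷ f))
      ≈⟨ addP-congʳ (scaleP b (a ∷ f)) (∷-cong refl (mulP-∷ʳ g a f)) ⟩
    addP (b * a ∷ scaleP b f) (0# ∷ addP (scaleP a g) (0# ∷ mulP g f))
      ≈⟨ ∷-cong (cong (_+ 0#) (*-comm b a)) (addP-leftComm (scaleP b f) (scaleP a g) _) ⟩
    addP (scaleP a (b ∷ g)) (0# ∷ addP (scaleP b f) (0# ∷ mulP g f))
      ∎
    where open ≋-Reasoning

  mulP-comm : ∀ f g → mulP f g ≋ mulP g f
  mulP-comm []      g = ≋-sym (mulP-zeroʳ g)
  mulP-comm (a ∷ f) g = ≋-trans (addP-congʳ (scaleP a g) (∷-cong refl (mulP-comm f g))) (≋-sym (mulP-∷ʳ g a f))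

  mulP-assoc : ∀ f g h → mulP (mulP f g) h ≋ mulP f (mulP g h)
  mulP-assoc []      g h = ≋-refl
  mulP-assoc (a ∷ f) g h = begin
    mulP (addP (scaleP a g) (0# ∷ mulP f g)) h
      ≈⟨ mulP-distribʳ (scaleP a g) _ h ⟩
    addP (mulP (scaleP a g) h) (mulP (0# ∷ mulP f g) h)
      ≈⟨ addP-cong (mulP-scaleˡ a g h) (mulP-0∷ˡ (mulP f g) h) ⟩
    addP (scaleP a (mulP g h)) (0# ∷ mulP (mulP f g) h)
      ≈⟨ addP-congʳ (scaleP a (mulP g h)) (∷-cong refl (mulP-assoc f g h)) ⟩
    addP (scaleP a (mulP g h)) (0# ∷ mulP f (mulP g h))
      ∎
    where open ≋-Reasoning

  mulP-leftComm : ∀ f g h → mulP f (mulP g h) ≋ mulP g (mulP f h)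
  mulP-leftComm f g h = ≋-trans (≋-sym (mulP-assoc f g h))
    (≋-trans (mulP-congˡ h (mulP-comm f g)) (mulP-assoc g f h))

  mulP-distribˡ : ∀ f g h → mulP f (addP g h) ≋ addP (mulP f g) (mulP f h)
  mulP-distribˡ f g h = ≋-trans (mulP-comm f _)
    (≋-trans (mulP-distribʳ g h f) (addP-cong (mulP-comm g f) (mulP-comm h f)))

  mulP-scaleʳ : ∀ a f g → mulP f (scaleP a g) ≋ scaleP a (mulP f g)
  mulP-scaleʳ a f g = ≋-trans (mulP-comm f _) (≋-trans (mulP-scaleˡ a g f) (scaleP-cong (mulP-comm g f)))

  mulP-0∷ʳ : ∀ f g → mulP f (0# ∷ g) ≋ 0# ∷ mulP f g
  mulP-0∷ʳ f g = ≋-trans (mulP-comm f _) (≋-trans (mulP-0∷ˡ g f) (∷-cong refl (mulP-comm g f)))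

  mulP-constˡ : ∀ a g → mulP (a ∷ []) g ≋ scaleP a g
  mulP-constˡ a g = ≋-trans (addP-congʳ (scaleP a g) 0∷[]≋[]) (addP-identityʳ _)

  mulP-identityˡ : ∀ g → mulP (1# ∷ []) g ≋ g
  mulP-identityˡ g = ≋-trans (mulP-constˡ 1# g) (scaleP-identity g)

  -- Congruence modulo a polynomial

  module Modulo (M : Poly) where
    infix 4 _∼_
    record _∼_ (f g : Poly) : Set where
      constructor ∼-intro
      field
        quotient   : Poly
        ≋-quotient : f ≋ addP g (mulP M quotient)

    ≋⇒∼ : ∀ {f g} → f ≋ g → f ∼ g
    ≋⇒∼ {g = g} e = ∼-intro [] (≋-trans e (≋-sym (≋-trans (addP-congʳ g (mulP-zeroʳ M)) (addP-identityʳ g))))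

    ∼-refl : ∀ {f} → f ∼ f
    ∼-refl = ≋⇒∼ ≋-refl

    ∼-sym : ∀ {f g} → f ∼ g → g ∼ f
    ∼-sym {f} {g} (∼-intro u e) = ∼-intro (negP u) (≋-sym (begin
      addP f (mulP M (negP u))                          ≈⟨ addP-cong e (mulP-scaleʳ (- 1#) M u) ⟩
      addP (addP g (mulP M u)) (negP (mulP M u))        ≈⟨ addP-assoc g _ _ ⟩
      addP g (addP (mulP M u) (negP (mulP M u)))        ≈⟨ addP-congʳ g (addP-inverseʳ (mulP M u)) ⟩
      addP g []                                         ≈⟨ addP-identityʳ g ⟩
      g                                                 ∎))
      where open ≋-Reasoning

    ∼-trans : ∀ {f g h} → f ∼ g → g ∼ h → f ∼ h
    ∼-trans {f} {g} {h} (∼-intro u e) (∼-intro v e′) = ∼-intro (addP v u) (begin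
      f                                          ≈⟨ e ⟩
      addP g (mulP M u)                          ≈⟨ addP-congˡ (mulP M u) e′ ⟩
      addP (addP h (mulP M v)) (mulP M u)        ≈⟨ addP-assoc h _ _ ⟩
      addP h (addP (mulP M v) (mulP M u))        ≈⟨ addP-congʳ h (mulP-distribˡ M v u) ⟨
      addP h (mulP M (addP v u))                 ∎)
      where open ≋-Reasoning

    ∼-setoid : Setoid 0ℓ 0ℓ
    ∼-setoid = record { Carrier = Poly ; _≈_ = _∼_
                      ; isEquivalence = record { refl = ∼-refl ; sym = ∼-sym ; trans = ∼-trans } }

    module ∼-Reasoning = SetoidReasoning ∼-setoid

    ∼-addP : ∀ {f g f′ g′} → f ∼ g → f′ ∼ g′ → addP f f′ ∼ addP g g′
    ∼-addP {f} {g} {f′} {g′} (∼-intro u e) (∼-intro v e′) = ∼-intro (addP u v) (begin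
      addP f f′                                          ≈⟨ addP-cong e e′ ⟩
      addP (addP g (mulP M u)) (addP g′ (mulP M v))      ≈⟨ addP-interchange g _ g′ _ ⟩
      addP (addP g g′) (addP (mulP M u) (mulP M v))      ≈⟨ addP-congʳ (addP g g′) (mulP-distribˡ M u v) ⟨
      addP (addP g g′) (mulP M (addP u v))               ∎)
      where open ≋-Reasoning

    ∼-mulPˡ : ∀ h {f g} → f ∼ g → mulP h f ∼ mulP h g
    ∼-mulPˡ h {f} {g} (∼-intro u e) = ∼-intro (mulP h u) (begin
      mulP h f                                   ≈⟨ mulP-congʳ h e ⟩
      mulP h (addP g (mulP M u))                 ≈⟨ mulP-distribˡ h g _ ⟩
      addP (mulP h g) (mulP h (mulP M u))        ≈⟨ addP-congʳ (mulP h g) (mulP-leftComm h M u) ⟩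
      addP (mulP h g) (mulP M (mulP h u))        ∎)
      where open ≋-Reasoning

    ∼-scaleP : ∀ a {f g} → f ∼ g → scaleP a f ∼ scaleP a g
    ∼-scaleP a {f} {g} f∼g =
      ∼-trans (≋⇒∼ (≋-sym (mulP-constˡ a f))) (∼-trans (∼-mulPˡ (a ∷ []) f∼g) (≋⇒∼ (mulP-constˡ a g)))

    ∼-0∷ : ∀ {f g} → f ∼ g → 0# ∷ f ∼ 0# ∷ g
    ∼-0∷ {f} {g} (∼-intro u e) = ∼-intro (0# ∷ u) (begin
      0# ∷ f                                 ≈⟨ ∷-cong refl e ⟩
      0# ∷ addP g (mulP M u)                 ≈⟨ 0∷-addP g _ ⟩
      addP (0# ∷ g) (0# ∷ mulP M u)          ≈⟨ addP-congʳ (0# ∷ g) (mulP-0∷ʳ M u) ⟨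
      addP (0# ∷ g) (mulP M (0# ∷ u))        ∎)
      where open ≋-Reasoning

    ∣⇒∼[] : ∀ {f} → M ∣ₚ f → f ∼ []
    ∣⇒∼[] (u , e) = ∼-intro u (mk≋ (sym ∘ e))

    ∼[]⇒∣ : ∀ {f} → f ∼ [] → M ∣ₚ f
    ∼[]⇒∣ (∼-intro u e) = u , sym ∘ coeff-≡ e

  -- Division by a monic polynomial and minimal polynomials

  DegreeBelow : Poly → ℕ → Set
  DegreeBelow r d = ∀ i → d ≤ i → coeff r i ≡ 0#

  divMonic : ∀ c d → MonicDeg c d → ∀ f → ∃ λ u → ∃ λ r → f ≋ addP (mulP c u) r × DegreeBelow r d
  divMonic c d mc [] = [] , [] , ≋-sym (≋-trans (addP-identityʳ (mulP c [])) (mulP-zeroʳ c)) , λ _ _ → refl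
  divMonic c d mc@(c-lead , c-above) (a ∷ f) with divMonic c d mc f
  ... | u′ , r′ , f≋ , r′-below = u , r , a∷f≋ , r-below
    where
    -- a ∷ f = x f + a ≋ c (x u′) + (a ∷ r′),
    -- and the coefficient b of a ∷ r′ at degree d is cancelled by b c.
    b = coeff (a ∷ r′) d
    u = addP (0# ∷ u′) (b ∷ [])
    r = addP (a ∷ r′) (scaleP (- b) c)

    a∷f≋ : a ∷ f ≋ addP (mulP c u) r
    a∷f≋ = ≋-sym (begin
      addP (mulP c u) r
        ≈⟨ addP-congˡ r (mulP-distribˡ c (0# ∷ u′) (b ∷ [])) ⟩
      addP (addP (mulP c (0# ∷ u′)) (mulP c (b ∷ []))) r
        ≈⟨ addP-congˡ r (addP-cong (mulP-0∷ʳ c u′) (≋-trans (mulP-comm c (b ∷ [])) (mulP-constˡ b c))) ⟩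
      addP (addP (0# ∷ mulP c u′) (scaleP b c)) (addP (a ∷ r′) (scaleP (- b) c))
        ≈⟨ addP-interchange (0# ∷ mulP c u′) (scaleP b c) (a ∷ r′) (scaleP (- b) c) ⟩
      addP (addP (0# ∷ mulP c u′) (a ∷ r′)) (addP (scaleP b c) (scaleP (- b) c))
        ≈⟨ addP-congʳ (addP (0# ∷ mulP c u′) (a ∷ r′)) cancel ⟩
      addP (addP (0# ∷ mulP c u′) (a ∷ r′)) []
        ≈⟨ addP-identityʳ _ ⟩
      (0# + a) ∷ addP (mulP c u′) r′
        ≈⟨ ∷-cong (+-identityˡ a) (≋-sym f≋) ⟩
      a ∷ f
        ∎)
      where
      open ≋-Reasoning
      cancel : addP (scaleP b c) (scaleP (- b) c) ≋ []
      cancel = ≋-trans (≋-sym (scaleP-distrib-+ b (- b) c))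
                 (≋-trans (scaleP-congˡ c (-‿inverseʳ b)) (scaleP-zero c))

    coeff-r : ∀ i → coeff r i ≡ coeff (a ∷ r′) i + - b * coeff c i
    coeff-r i = trans (coeff-addP (a ∷ r′) (scaleP (- b) c) i) (cong (coeff (a ∷ r′) i +_) (coeff-scaleP (- b) c i))

    r-below : DegreeBelow r d
    r-below i d≤i with ℕ.m≤n⇒m<n∨m≡n d≤i
    ... | inj₂ refl = begin
      coeff r d                  ≡⟨ coeff-r d ⟩
      b + - b * coeff c d        ≡⟨ cong (λ x → b + - b * x) c-lead ⟩
      b + - b * 1#               ≡⟨ cong (b +_) (*-identityʳ (- b)) ⟩
      b + - b                    ≡⟨ -‿inverseʳ b ⟩
      0#                         ∎
      where open ≡-Reasoning
    r-below (suc i) _ | inj₁ (s≤s d≤i) = begin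
      coeff r (suc i)                        ≡⟨ coeff-r (suc i) ⟩
      coeff r′ i + - b * coeff c (suc i)
        ≡⟨ cong₂ (λ x y → x + - b * y) (r′-below i d≤i) (c-above (suc i) (s≤s d≤i)) ⟩
      0# + - b * 0#                          ≡⟨ +-identityˡ _ ⟩
      - b * 0#                               ≡⟨ zeroʳ (- b) ⟩
      0#                                     ∎
      where open ≡-Reasoning

  highestNonzero : ∀ r b → DegreeBelow r b → r ≋ [] ⊎ ∃ λ t → coeff r t ≢ 0# × DegreeBelow r (suc t)
  highestNonzero r zero    r<0   = inj₁ (mk≋ λ i → r<0 i z≤n)
  highestNonzero r (suc b) r<1+b with coeff r b ≟ 0#
  ... | no  rb≢0 = inj₂ (b , rb≢0 , r<1+b)
  ... | yes rb≡0 = highestNonzero r b r<b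
    where
    r<b : DegreeBelow r b
    r<b i b≤i with ℕ.m≤n⇒m<n∨m≡n b≤i
    ... | inj₁ b<i = r<1+b i b<i
    ... | inj₂ refl = rb≡0

  normaliseMonic : ∀ {r t} → coeff r t ≢ 0# → DegreeBelow r (suc t) → ∃ λ ρ → MonicDeg (scaleP ρ r) t
  normaliseMonic {r} {t} rt≢0 r<t+1 with inverse (coeff r t) rt≢0
  ... | ρ , rρ = ρ , trans (coeff-scaleP ρ r t) (trans (*-comm ρ _) rρ)
                   , λ i t<i → trans (coeff-scaleP ρ r i) (trans (cong (ρ *_) (r<t+1 i t<i)) (zeroʳ ρ))

  toPoly-scale : ∀ {n} α (z : A n) → toPoly (scale α z) ≡ scaleP α (toPoly z)
  toPoly-scale α = Vec.toList-map (α *_)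

  module _ {n : ℕ} where
    open Modulo (xpow-1 n)

    annihilates-scaleP : ∀ ρ {c} {z : A n} → Annihilates c z → Annihilates (scaleP ρ c) z
    annihilates-scaleP ρ {c} {z} ac = ∼[]⇒∣ (begin
      mulP (scaleP ρ c) (toPoly z)    ≈⟨ ≋⇒∼ (mulP-scaleˡ ρ c (toPoly z)) ⟩
      scaleP ρ (mulP c (toPoly z))    ≈⟨ ∼-scaleP ρ (∣⇒∼[] ac) ⟩
      scaleP ρ []                     ≡⟨⟩
      []                              ∎)
      where open ∼-Reasoning

    annihilates-scale : ∀ c α (z : A n) → Annihilates c z → Annihilates c (scale α z)
    annihilates-scale c α z ac = ∼[]⇒∣ (begin
      mulP c (toPoly (scale α z))     ≡⟨ cong (mulP c) (toPoly-scale α z) ⟩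
      mulP c (scaleP α (toPoly z))    ≈⟨ ≋⇒∼ (mulP-scaleʳ α c (toPoly z)) ⟩
      scaleP α (mulP c (toPoly z))    ≈⟨ ∼-scaleP α (∣⇒∼[] ac) ⟩
      []                              ∎)
      where open ∼-Reasoning

    annihilates-multiple : ∀ {c f} {z : A n} → c ∣ₚ f → Annihilates c z → Annihilates f z
    annihilates-multiple {c} {f} {z} (v , cv≈f) ac = ∼[]⇒∣ (begin
      mulP f Z            ≈⟨ ≋⇒∼ (mulP-congˡ {mulP c v} {f} Z (mk≋ cv≈f)) ⟨
      mulP (mulP c v) Z   ≈⟨ ≋⇒∼ (≋-trans (mulP-congˡ Z (mulP-comm c v)) (mulP-assoc v c Z)) ⟩
      mulP v (mulP c Z)   ≈⟨ ∼-mulPˡ v (∣⇒∼[] ac) ⟩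
      mulP v []           ≈⟨ ≋⇒∼ (mulP-zeroʳ v) ⟩
      []                  ∎)
      where
      open ∼-Reasoning
      Z = toPoly z

    annihilates-remainder : ∀ {c u f r} {z : A n} → f ≋ addP (mulP c u) r →
                            Annihilates f z → Annihilates c z → Annihilates r z
    annihilates-remainder {c} {u} {f} {r} {z} f≋ af ac = ∼[]⇒∣ (begin
      mulP r Z                                 ≡⟨⟩
      addP [] (mulP r Z)                       ≈⟨ ∼-addP cuZ∼0 ∼-refl ⟨
      addP (mulP (mulP c u) Z) (mulP r Z)      ≈⟨ ≋⇒∼ (mulP-distribʳ (mulP c u) r Z) ⟨
      mulP (addP (mulP c u) r) Z               ≈⟨ ≋⇒∼ (mulP-congˡ Z f≋) ⟨
      mulP f Z                                 ≈⟨ ∣⇒∼[] af ⟩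
      []                                       ∎)
      where
      open ∼-Reasoning
      Z = toPoly z
      cuZ∼0 : mulP (mulP c u) Z ∼ []
      cuZ∼0 = begin
        mulP (mulP c u) Z   ≈⟨ ≋⇒∼ (≋-trans (mulP-congˡ Z (mulP-comm c u)) (mulP-assoc u c Z)) ⟩
        mulP u (mulP c Z)   ≈⟨ ∼-mulPˡ u (∣⇒∼[] ac) ⟩
        mulP u []           ≈⟨ ≋⇒∼ (mulP-zeroʳ u) ⟩
        []                  ∎

    minPoly-divides : ∀ {z : A n} {c f} → IsMinPoly z c → Annihilates f z → c ∣ₚ f
    minPoly-divides {z} {c} {f} (d , mc , ac , minimal) af with divMonic c d mc f
    ... | u , r , f≋ , r<d with highestNonzero r d r<d
    ... | inj₁ r≋0 = u , coeff-≡ (≋-sym (≋-trans f≋ (≋-trans (addP-congʳ (mulP c u) r≋0) (addP-identityʳ _))))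
    ... | inj₂ (t , rt≢0 , r<t+1) with normaliseMonic {r} {t} rt≢0 r<t+1
    ... | ρ , monic = ⊥-elim (ℕ.<⇒≱ t<d (minimal (scaleP ρ r) t monic ρr-annihilates))
      where
      t<d : t < d
      t<d = ℕ.≰⇒> (rt≢0 ∘ r<d t)

      ρr-annihilates : Annihilates (scaleP ρ r) z
      ρr-annihilates = annihilates-scaleP ρ {r} (annihilates-remainder {c} {u} f≋ af ac)

  -- Reduced representatives in A n and the cyclic shift

  xpow : ℕ → Poly
  xpow e = replicate e 0# ++ 1# ∷ []

  mulP-xpow : ∀ e u → mulP (xpow e) u ≋ replicate e 0# ++ u
  mulP-xpow zero    u = mulP-identityˡ u
  mulP-xpow (suc e) u = ≋-trans (mulP-0∷ˡ (xpow e) u) (∷-cong refl (mulP-xpow e u))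

  xpow≋xpow-1+1 : ∀ e → xpow e ≋ addP (xpow-1 e) (1# ∷ [])
  xpow≋xpow-1+1 e =
    ≋-sym (≋-trans (addP-assoc (xpow e) _ _) (≋-trans (addP-congʳ (xpow e) -1+1≋0) (addP-identityʳ (xpow e))))
    where
    -1+1≋0 : addP (- 1# ∷ []) (1# ∷ []) ≋ []
    -1+1≋0 = mk≋ λ { zero → -‿inverseˡ 1# ; (suc i) → refl }

  mulP-xpow-1 : ∀ e u → mulP (xpow-1 e) u ≋ addP (mulP (xpow e) u) (negP u)
  mulP-xpow-1 e u = ≋-trans (mulP-distribʳ (xpow e) _ u) (addP-congʳ (mulP (xpow e) u) (mulP-constˡ (- 1#) u))

  coeff-replicate-++ : ∀ n u i → coeff (replicate n 0# ++ u) (n ℕ.+ i) ≡ coeff u i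
  coeff-replicate-++ zero    u i = refl
  coeff-replicate-++ (suc n) u i = coeff-replicate-++ n u i

  coeff-beyond-length : ∀ u i → List.length u ≤ i → coeff u i ≡ 0#
  coeff-beyond-length []      i       _         = refl
  coeff-beyond-length (a ∷ u) (suc i) (s≤s l≤i) = coeff-beyond-length u i l≤i

  coeff-toPoly-∷ʳ : ∀ {m} (ys : A m) y j → coeff (toPoly (ys ∷ʳ y)) j ≡ coeff (toPoly ys) j + y * coeff (xpow m) j
  coeff-toPoly-∷ʳ []       y zero    = sym (trans (+-identityˡ _) (*-identityʳ y))
  coeff-toPoly-∷ʳ []       y (suc j) = sym (trans (+-identityˡ _) (zeroʳ y))
  coeff-toPoly-∷ʳ (a ∷ ys) y zero    = sym (trans (cong (a +_) (zeroʳ y)) (+-identityʳ a))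
  coeff-toPoly-∷ʳ (a ∷ ys) y (suc j) = coeff-toPoly-∷ʳ ys y j

  toPoly-injective : ∀ {n} {v w : A n} → toPoly v ≋ toPoly w → v ≡ w
  toPoly-injective {v = []}    {[]}    e = refl
  toPoly-injective {v = a ∷ v} {b ∷ w} e = cong₂ _∷_ (coeff-≡ e zero) (toPoly-injective (∷-injectiveʳ e))

  periodic⇒≋[] : ∀ p u → (∀ i → coeff u i ≡ coeff u (suc p ℕ.+ i)) → u ≋ []
  periodic⇒≋[] p u periodic = mk≋ λ i → trans (shift (List.length u) i)
    (coeff-beyond-length u _ (ℕ.≤-trans (ℕ.m≤m*n (List.length u) (suc p)) (ℕ.m≤m+n _ i)))
    where
    shift : ∀ k i → coeff u i ≡ coeff u (k ℕ.* suc p ℕ.+ i)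
    shift zero    i = refl
    shift (suc k) i = trans (shift k i) (trans (periodic _) (cong (coeff u) (sym (ℕ.+-assoc (suc p) (k ℕ.* suc p) i))))

  module _ {m : ℕ} where
    open Modulo (xpow-1 (suc m))

    reduced-unique : ∀ {v w : A (suc m)} → toPoly v ∼ toPoly w → v ≡ w
    reduced-unique {v} {w} (∼-intro u v≋) = toPoly-injective (≋-trans v≋
      (≋-trans (addP-congʳ (toPoly w) (≋-trans (mulP-congʳ M u≋[]) (mulP-zeroʳ M))) (addP-identityʳ _)))
      where
      n = suc m
      M = xpow-1 n

      coeff-high : ∀ (x : A n) i → coeff (toPoly x) (n ℕ.+ i) ≡ 0#
      coeff-high x i = coeff-beyond-length (toPoly x) (n ℕ.+ i)
        (subst (_≤ n ℕ.+ i) (sym (Vec.length-toList x)) (ℕ.m≤m+n n i))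

      -- Comparing the coefficients at degree n + i, where v and w vanish, gives u i - u (n + i) = 0.
      u-periodic : ∀ i → coeff u i ≡ coeff u (n ℕ.+ i)
      u-periodic i = x∙y⁻¹≈ε⇒x≈y _ _ (sym (begin
        0#                                                     ≡⟨ coeff-high v i ⟨
        coeff (toPoly v) (n ℕ.+ i)                             ≡⟨ coeff-≡ v≋ (n ℕ.+ i) ⟩
        coeff (addP (toPoly w) (mulP M u)) (n ℕ.+ i)           ≡⟨ coeff-addP (toPoly w) _ (n ℕ.+ i) ⟩
        coeff (toPoly w) (n ℕ.+ i) + coeff (mulP M u) (n ℕ.+ i)
          ≡⟨ cong₂ _+_ (coeff-high w i) (coeff-≡ (mulP-xpow-1 n u) (n ℕ.+ i)) ⟩
        0# + coeff (addP (mulP (xpow n) u) (negP u)) (n ℕ.+ i)  ≡⟨ +-identityˡ _ ⟩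
        coeff (addP (mulP (xpow n) u) (negP u)) (n ℕ.+ i)       ≡⟨ coeff-addP (mulP (xpow n) u) (negP u) (n ℕ.+ i) ⟩
        coeff (mulP (xpow n) u) (n ℕ.+ i) + coeff (negP u) (n ℕ.+ i)
          ≡⟨ cong₂ _+_ (trans (coeff-≡ (mulP-xpow n u) (n ℕ.+ i)) (coeff-replicate-++ n u i))
                       (trans (coeff-scaleP (- 1#) u (n ℕ.+ i)) (-1*x≈-x _)) ⟩
        coeff u i + - coeff u (n ℕ.+ i)                          ∎))
        where open ≡-Reasoning

      u≋[] : u ≋ []
      u≋[] = periodic⇒≋[] m u u-periodic

    toPoly-mulX : ∀ (z : A (suc m)) → toPoly (mulX z) ∼ 0# ∷ toPoly z
    toPoly-mulX z with Vec.initLast z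
    ... | ys , y , refl = ∼-sym (∼-intro (y ∷ [])
      (≋-sym (≋-trans (addP-congʳ (y ∷ toPoly ys) (≋-trans (mulP-comm M _) (mulP-constˡ y M))) (mk≋ coeff≡))))
      where
      -- x (ys + y xᵐ) = (y ∷ ys) + y (xᵐ⁺¹ - 1)
      M = xpow-1 (suc m)
      coeff≡ : ∀ i → coeff (addP (y ∷ toPoly ys) (scaleP y M)) i ≡ coeff (0# ∷ toPoly (ys ∷ʳ y)) i
      coeff≡ zero = begin
        y + y * (0# + - 1#)   ≡⟨ cong (λ a → y + y * a) (+-identityˡ (- 1#)) ⟩
        y + y * - 1#          ≡⟨ cong (y +_) (-‿distribʳ-* y 1#) ⟨
        y + - (y * 1#)        ≡⟨ cong (λ a → y + - a) (*-identityʳ y) ⟩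
        y + - y               ≡⟨ -‿inverseʳ y ⟩
        0#                    ∎
        where open ≡-Reasoning
      coeff≡ (suc j) = begin
        coeff (addP (toPoly ys) (scaleP y (addP (xpow m) []))) j  ≡⟨ coeff-addP (toPoly ys) _ j ⟩
        coeff (toPoly ys) j + coeff (scaleP y (addP (xpow m) [])) j
          ≡⟨ cong (coeff (toPoly ys) j +_) (trans (coeff-scaleP y (addP (xpow m) []) j)
                                                  (cong (y *_) (coeff-≡ (addP-identityʳ (xpow m)) j))) ⟩
        coeff (toPoly ys) j + y * coeff (xpow m) j                ≡⟨ coeff-toPoly-∷ʳ ys y j ⟨
        coeff (toPoly (ys ∷ʳ y)) j                                ∎
        where open ≡-Reasoning

    toPoly-mulXPow : ∀ e (z : A (suc m)) → toPoly (mulXPow e z) ∼ mulP (xpow e) (toPoly z)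
    toPoly-mulXPow zero    z = ≋⇒∼ (≋-sym (mulP-identityˡ (toPoly z)))
    toPoly-mulXPow (suc e) z = begin
      toPoly (mulX (mulXPow e z))          ≈⟨ toPoly-mulX (mulXPow e z) ⟩
      0# ∷ toPoly (mulXPow e z)            ≈⟨ ∼-0∷ (toPoly-mulXPow e z) ⟩
      0# ∷ mulP (xpow e) (toPoly z)        ≈⟨ ≋⇒∼ (mulP-0∷ˡ (xpow e) (toPoly z)) ⟨
      mulP (xpow (suc e)) (toPoly z)       ∎
      where open ∼-Reasoning

    annihilates-mulXPow : ∀ c e (z : A (suc m)) → Annihilates c z → Annihilates c (mulXPow e z)
    annihilates-mulXPow c e z ac = ∼[]⇒∣ (begin
      mulP c (toPoly (mulXPow e z))   ≈⟨ ∼-mulPˡ c (toPoly-mulXPow e z) ⟩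
      mulP c (mulP (xpow e) Z)        ≈⟨ ≋⇒∼ (mulP-leftComm c (xpow e) Z) ⟩
      mulP (xpow e) (mulP c Z)        ≈⟨ ∼-mulPˡ (xpow e) (∣⇒∼[] ac) ⟩
      mulP (xpow e) []                ≈⟨ ≋⇒∼ (mulP-zeroʳ (xpow e)) ⟩
      []                              ∎)
      where
      open ∼-Reasoning
      Z = toPoly z

    mulXPow-period : ∀ {c} e {z : A (suc m)} → c ∣ₚ xpow-1 e → Annihilates c z → mulXPow e z ≡ z
    mulXPow-period {c} e {z} c∣xᵉ-1 ac = reduced-unique (begin
      toPoly (mulXPow e z)                               ≈⟨ toPoly-mulXPow e z ⟩
      mulP (xpow e) Z                                    ≈⟨ ≋⇒∼ (mulP-congˡ Z (xpow≋xpow-1+1 e)) ⟩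
      mulP (addP (xpow-1 e) (1# ∷ [])) Z                 ≈⟨ ≋⇒∼ (mulP-distribʳ (xpow-1 e) _ Z) ⟩
      addP (mulP (xpow-1 e) Z) (mulP (1# ∷ []) Z)        ≈⟨ ∼-addP {f = mulP (xpow-1 e) Z} xᵉ-1Z∼0 (≋⇒∼ (mulP-identityˡ Z)) ⟩
      Z                                                  ∎)
      where
      open ∼-Reasoning
      Z = toPoly z
      xᵉ-1Z∼0 : mulP (xpow-1 e) Z ∼ []
      xᵉ-1Z∼0 = ∣⇒∼[] (annihilates-multiple {c = c} {f = xpow-1 e} c∣xᵉ-1 ac)

    annihilates-of-fixed : ∀ e {z : A (suc m)} → mulXPow e z ≡ z → Annihilates (xpow-1 e) z
    annihilates-of-fixed e {z} fixed = ∼[]⇒∣ (begin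
      mulP (xpow-1 e) Z                         ≈⟨ ≋⇒∼ (mulP-xpow-1 e Z) ⟩
      addP (mulP (xpow e) Z) (negP Z)           ≈⟨ ∼-addP (toPoly-mulXPow e z) ∼-refl ⟨
      addP (toPoly (mulXPow e z)) (negP Z)      ≡⟨ cong (λ w → addP (toPoly w) (negP Z)) fixed ⟩
      addP Z (negP Z)                           ≈⟨ ≋⇒∼ (addP-inverseʳ Z) ⟩
      []                                        ∎)
      where
      open ∼-Reasoning
      Z = toPoly z

  -- Orbits of the shift and of the scalars

  mulXPow-+ : ∀ {n} a b (z : A n) → mulXPow (a ℕ.+ b) z ≡ mulXPow a (mulXPow b z)
  mulXPow-+ zero    b z = refl
  mulXPow-+ (suc a) b z = cong mulX (mulXPow-+ a b z)

  scale-scale : ∀ {n} a b (z : A n) → scale a (scale b z) ≡ scale (a * b) z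
  scale-scale a b []      = refl
  scale-scale a b (x ∷ z) = cong₂ _∷_ (sym (*-assoc a b x)) (scale-scale a b z)

  scale-identity : ∀ {n} (z : A n) → scale 1# z ≡ z
  scale-identity []      = refl
  scale-identity (x ∷ z) = cong₂ _∷_ (*-identityˡ x) (scale-identity z)

  scale-inverse : ∀ {n} {a b} (z : A n) → a * b ≡ 1# → scale b (scale a z) ≡ z
  scale-inverse z ab≡1 = trans (scale-scale _ _ z) (trans (cong (λ x → scale x z) (trans (*-comm _ _) ab≡1)) (scale-identity z))

  scale-cancel : ∀ {n} (z : A n) a b → scale a z ≡ scale b z → a ≡ b ⊎ toPoly z ≋ []
  scale-cancel []      a b e = inj₂ ≋-refl
  scale-cancel (x ∷ z) a b e with Vec.∷-injective e | x ≟ 0#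
  ... | _  , ez | yes x≡0 = map₂ (λ z≋[] → ≋-trans (∷-cong x≡0 z≋[]) 0∷[]≋[]) (scale-cancel z a b ez)
  ... | ex , _  | no  x≢0 = inj₁ (*-cancelʳ-nonzero a b x≢0 ex)

  module _ {n : ℕ} (C : A n → Set) (Orbit : A n → A n → Set) where

    record FreeOrbits (g : ℕ) : Set where
      field
        act        : Fin g → A n → A n
        act-closed : ∀ {z} a → C z → C (act a z)
        orbit-refl : ∀ {z} → C z → Orbit z z
        orbit-act  : ∀ {z w} → C z → Orbit z w → ∃ λ a → act a z ≡ w
        orbit-⊆    : ∀ {z z′ w} a a′ → C z → C z′ → act a z ≡ act a′ z′ → Orbit z w → Orbit z′ w
        act-free   : ∀ {z} a a′ → C z → act a z ≡ act a′ z → a ≡ a′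

    orbitEnumeration : ∀ {s g} → NumDistinct C Orbit s → FreeOrbits g → Enumeration {I = Fin s × Fin g} C
    orbitEnumeration {s} {g} (rep , rep-∈ , rep-distinct , rep-covers) O = record
      { elem            = elem
      ; elem-∈          = λ (i , a) → act-closed a (rep-∈ i)
      ; elem-injective  = injective
      ; elem-surjective = surjective
      }
      where
      open FreeOrbits O

      elem : Fin s × Fin g → A n
      elem (i , a) = act a (rep i)

      injective : Injective _≡_ _≡_ elem
      injective {i , a} {j , b} e
        with rep-distinct i j (λ w → orbit-⊆ a b (rep-∈ i) (rep-∈ j) e , orbit-⊆ b a (rep-∈ j) (rep-∈ i) (sym e))
      ... | refl = cong (i ,_) (act-free a b (rep-∈ i) e)

      surjective : ∀ z → C z → ∃ λ x → elem x ≡ z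
      surjective z cz with rep-covers z cz
      ... | i , same with orbit-act (rep-∈ i) (proj₁ (same z) (orbit-refl cz))
      ... | a , e = (i , a) , e

  scale-shared : ∀ {n} {α α′ γ} {z z′ : A n} → α ≢ 0# → α′ ≢ 0# → γ ≢ 0# →
                 scale α z ≡ scale α′ z′ → InPropClass z′ (scale γ z)
  scale-shared {α = α} {α′} {γ} {z} {z′} α≢0 α′≢0 γ≢0 e with inverse α α≢0
  ... | β , αβ≡1 = γ * (β * α′) , *-nonzero γ≢0 (*-nonzero (inverse-nonzero αβ≡1) α′≢0) , (begin
    scale γ z                          ≡⟨ cong (scale γ) (scale-inverse z αβ≡1) ⟨
    scale γ (scale β (scale α z))      ≡⟨ cong (scale γ ∘ scale β) e ⟩
    scale γ (scale β (scale α′ z′))    ≡⟨ cong (scale γ) (scale-scale β α′ z′) ⟩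
    scale γ (scale (β * α′) z′)        ≡⟨ scale-scale γ _ z′ ⟩
    scale (γ * (β * α′)) z′            ∎)
    where open ≡-Reasoning

  monicDeg0⇒≈1 : ∀ {c} → MonicDeg c 0 → c ≈ₚ (1# ∷ [])
  monicDeg0⇒≈1 (c₀≡1 , _)     zero    = c₀≡1
  monicDeg0⇒≈1 (_    , above) (suc i) = above (suc i) (s≤s z≤n)

  module CyclicCode {m p : ℕ} (h c : Poly) (ord : IsOrd c (suc p)) (c-nonconstant : ¬ MonicDeg c 0) where
    open Modulo (xpow-1 (suc m)) using (≋⇒∼; ∼[]⇒∣)

    nc : ℕ
    nc = suc p

    C : A (suc m) → Set
    C z = InIdeal h z × IsMinPoly z c

    sameAnnihilators : ∀ z w → (∀ f → Annihilates f z → Annihilates f w) →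
                       (∀ f → Annihilates f w → Annihilates f z) → C z → C w
    sameAnnihilators z w z⊆w w⊆z (hz , d , mc , cz , minimal) =
      z⊆w h hz , d , mc , z⊆w c cz , λ c′ d′ mc′ c′w → minimal c′ d′ mc′ (w⊆z c′ c′w)

    mulXPow-nc : ∀ {z} → C z → mulXPow nc z ≡ z
    mulXPow-nc (_ , _ , _ , cz , _) = mulXPow-period {c = c} nc (proj₁ (proj₂ ord)) cz

    mulXPow-multiple : ∀ {z} → C z → ∀ k → mulXPow (k ℕ.* nc) z ≡ z
    mulXPow-multiple     cz zero    = refl
    mulXPow-multiple {z} cz (suc k) =
      trans (mulXPow-+ nc (k ℕ.* nc) z) (trans (cong (mulXPow nc) (mulXPow-multiple cz k)) (mulXPow-nc cz))

    mulXPow-mod : ∀ {z} → C z → ∀ k → mulXPow (k ℕ.% nc) z ≡ mulXPow k z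
    mulXPow-mod {z} cz k = begin
      mulXPow (k ℕ.% nc) z                                ≡⟨ cong (mulXPow (k ℕ.% nc)) (mulXPow-multiple cz (k ℕ./ nc)) ⟨
      mulXPow (k ℕ.% nc) (mulXPow (k ℕ./ nc ℕ.* nc) z)    ≡⟨ mulXPow-+ (k ℕ.% nc) _ z ⟨
      mulXPow (k ℕ.% nc ℕ.+ k ℕ./ nc ℕ.* nc) z            ≡⟨ cong (λ e → mulXPow e z) (ℕ.m≡m%n+[m/n]*n k nc) ⟨
      mulXPow k z                                         ∎
      where open ≡-Reasoning

    mulXPow-undo : ∀ {z} → C z → ∀ j → mulXPow (j ℕ.* p) (mulXPow j z) ≡ z
    mulXPow-undo {z} cz j = begin
      mulXPow (j ℕ.* p) (mulXPow j z)   ≡⟨ mulXPow-+ (j ℕ.* p) j z ⟨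
      mulXPow (j ℕ.* p ℕ.+ j) z         ≡⟨ cong (λ e → mulXPow e z) (trans (ℕ.*-suc j p) (ℕ.+-comm j (j ℕ.* p))) ⟨
      mulXPow (j ℕ.* nc) z              ≡⟨ mulXPow-multiple cz j ⟩
      z                                 ∎
      where open ≡-Reasoning

    C-mulXPow : ∀ {z} j → C z → C (mulXPow j z)
    C-mulXPow {z} j cz = sameAnnihilators z (mulXPow j z) (λ f → annihilates-mulXPow f j z)
      (λ f af → subst (Annihilates f) (mulXPow-undo cz j) (annihilates-mulXPow f (j ℕ.* p) (mulXPow j z) af)) cz

    C-scale : ∀ {z α} → α ≢ 0# → C z → C (scale α z)
    C-scale {z} {α} α≢0 cz with inverse α α≢0
    ... | β , αβ≡1 = sameAnnihilators z (scale α z) (λ f → annihilates-scale f α z)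
      (λ f af → subst (Annihilates f) (scale-inverse z αβ≡1) (annihilates-scale f β (scale α z) af)) cz

    nc-minimalPeriod : ∀ {z} e → 1 ≤ e → C z → mulXPow e z ≡ z → nc ≤ e
    nc-minimalPeriod e 1≤e (_ , minPoly) fixed =
      proj₂ (proj₂ ord) e 1≤e (minPoly-divides {c = c} {xpow-1 e} minPoly (annihilates-of-fixed e fixed))

    mulXPow-distinct : ∀ {z a b} → C z → a < b → b < nc → mulXPow a z ≢ mulXPow b z
    mulXPow-distinct {z} {a} {b} cz a<b b<nc e =
      ℕ.<⇒≱ (ℕ.≤-<-trans (ℕ.m∸n≤m b a) b<nc)
            (nc-minimalPeriod (b ℕ.∸ a) (ℕ.m<n⇒0<n∸m a<b) (C-mulXPow a cz) fixed)
      where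
      fixed : mulXPow (b ℕ.∸ a) (mulXPow a z) ≡ mulXPow a z
      fixed = begin
        mulXPow (b ℕ.∸ a) (mulXPow a z)   ≡⟨ mulXPow-+ (b ℕ.∸ a) a z ⟨
        mulXPow (b ℕ.∸ a ℕ.+ a) z         ≡⟨ cong (λ e → mulXPow e z) (ℕ.m∸n+n≡m (ℕ.<⇒≤ a<b)) ⟩
        mulXPow b z                       ≡⟨ e ⟨
        mulXPow a z                       ∎
        where open ≡-Reasoning

    mulXPow-injective : ∀ {z a b} → C z → a < nc → b < nc → mulXPow a z ≡ mulXPow b z → a ≡ b
    mulXPow-injective {a = a} {b} cz a<nc b<nc e with ℕ.<-cmp a b
    ... | tri< a<b _ _ = ⊥-elim (mulXPow-distinct cz a<b b<nc e)
    ... | tri≈ _ a≡b _ = a≡b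
    ... | tri> _ _ b<a = ⊥-elim (mulXPow-distinct cz b<a a<nc (sym e))

    C-nonzero : ∀ {z} → C z → ¬ (toPoly z ≋ [])
    C-nonzero {z} (_ , d , mc , _ , minimal) z≋[] = c-nonconstant (subst (MonicDeg c) d≡0 mc)
      where
      1-annihilates : Annihilates (1# ∷ []) z
      1-annihilates = ∼[]⇒∣ (≋⇒∼ (≋-trans (mulP-identityˡ (toPoly z)) z≋[]))

      d≡0 : d ≡ 0
      d≡0 = ℕ.n≤0⇒n≡0 (minimal (1# ∷ []) 0 (refl , λ { zero () ; (suc i) _ → refl }) 1-annihilates)

    cycleOrbits : FreeOrbits C InCycle nc
    cycleOrbits = record
      { act        = mulXPow ∘ Fin.toℕ
      ; act-closed = C-mulXPow ∘ Fin.toℕ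
      ; orbit-refl = λ _ → 0 , refl
      ; orbit-act  = λ { {z} cz (k , refl) → Fin.fromℕ< (ℕ.m%n<n k nc) ,
                           trans (cong (λ e → mulXPow e z) (Fin.toℕ-fromℕ< (ℕ.m%n<n k nc))) (mulXPow-mod cz k) }
      ; orbit-⊆    = λ { {z} {z′} a a′ cz _ e (k , refl) → shared z z′ (Fin.toℕ a) (Fin.toℕ a′) cz e k }
      ; act-free   = λ a a′ cz e → Fin.toℕ-injective (mulXPow-injective cz (Fin.toℕ<n a) (Fin.toℕ<n a′) e)
      }
      where
      shared : ∀ z z′ a a′ → C z → mulXPow a z ≡ mulXPow a′ z′ → ∀ k → InCycle z′ (mulXPow k z)
      shared z z′ a a′ cz e k = k ℕ.+ (a ℕ.* p ℕ.+ a′) , (begin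
        mulXPow k z                                     ≡⟨ cong (mulXPow k) (mulXPow-undo cz a) ⟨
        mulXPow k (mulXPow (a ℕ.* p) (mulXPow a z))     ≡⟨ cong (mulXPow k ∘ mulXPow (a ℕ.* p)) e ⟩
        mulXPow k (mulXPow (a ℕ.* p) (mulXPow a′ z′))   ≡⟨ cong (mulXPow k) (mulXPow-+ (a ℕ.* p) a′ z′) ⟨
        mulXPow k (mulXPow (a ℕ.* p ℕ.+ a′) z′)         ≡⟨ mulXPow-+ k _ z′ ⟨
        mulXPow (k ℕ.+ (a ℕ.* p ℕ.+ a′)) z′             ∎)
        where open ≡-Reasoning

    scalarOrbits : ∀ {g} → Enumeration {I = Fin g} (_≢ 0#) → FreeOrbits C InPropClass g
    scalarOrbits units = record
      { act        = scale ∘ elem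
      ; act-closed = λ a → C-scale (elem-∈ a)
      ; orbit-refl = λ {z} _ → 1# , 1≢0 , sym (scale-identity z)
      ; orbit-act  = λ { {z} _ (α , α≢0 , refl) →
                           let (a , ea) = elem-surjective α α≢0 in a , cong (λ x → scale x z) ea }
      ; orbit-⊆    = λ { a a′ _ _ e (γ , γ≢0 , refl) → scale-shared (elem-∈ a) (elem-∈ a′) γ≢0 e }
      ; act-free   = λ {z} a a′ cz e →
                       [ elem-injective , (λ z≋[] → ⊥-elim (C-nonzero cz z≋[])) ]′ (scale-cancel z _ _ e)
      }
      where open Enumeration units

    cycles-vs-classes : ∀ {g s R} → Enumeration {I = Fin g} (_≢ 0#) →
                        NumDistinct C InCycle s → NumDistinct C InPropClass R → s ℕ.* nc ≡ R ℕ.* g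
    cycles-vs-classes units cycles classes = enumeration-size-unique
      (reindex Fin.*↔× (orbitEnumeration C InCycle cycles cycleOrbits))
      (reindex Fin.*↔× (orbitEnumeration C InPropClass classes (scalarOrbits units)))

-- Imported only here, since above _*_ is the multiplication of the field.
open import Data.Nat using (_*_; _∸_)
open import Data.Nat.Coprimality using (Coprime)

lemma1 : (q : ℕ) → IsPrimePower q → 2 < q → (𝔽 : FiniteField q) →
    let open Theory 𝔽 in
    (n : ℕ) → 1 ≤ n → Coprime n q →
    (t : ℕ) (hs : Fin t → Poly) →
    (∀ i → Monic (hs i)) → (∀ i → Irreducible (hs i)) →
    (∀ i → hs i ∣ₚ xpow-1 n) →
    (∀ i j → i ≢ j → ¬ (hs i ≈ₚ hs j)) →
    (k : ℕ) (σ : Fin k → Fin t) → Injective _≡_ _≡_ σ → 1 ≤ k →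
    (nc sc Rc : ℕ) →
    IsOrd (prodP (λ j → hs (σ j))) nc →
    NumDistinct {n} (λ z → InIdeal (prodP hs) z × IsMinPoly z (prodP (λ j → hs (σ j)))) InCycle sc →
    NumDistinct {n} (λ z → InIdeal (prodP hs) z × IsMinPoly z (prodP (λ j → hs (σ j)))) InPropClass Rc →
    nc * sc ≡ Rc * (q ∸ 1)
lemma1 _ _ _ _ (suc _) _ _ _ _ _ _ _ _ (suc _) _ _ _ zero _ _ (() , _)
lemma1 (suc _) _ _ 𝔽 (suc m) _ _ _ hs _ irreducible _ _ (suc _) σ _ _ (suc p) sc Rc ord cycles classes =
  trans (ℕ.*-comm (suc p) sc)
    (CyclicCode.cycles-vs-classes 𝔽 {m} (prodP hs) c ord c-nonconstant (punchedEnumeration enum 0#) cycles classes)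
  where
  open Theory 𝔽
  open FiniteField 𝔽 using (0#; enum)

  c : Poly
  c = prodP (λ j → hs (σ j))

  c-nonconstant : ¬ MonicDeg c 0
  c-nonconstant c-monic0 =
    proj₁ (proj₂ (irreducible (σ Fin.zero))) (prodP (λ j → hs (σ (Fin.suc j))) , monicDeg0⇒≈1 𝔽 {c} c-monic0)
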